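{- Let $r\ge 1$ and $n\ge 1$ be integers. Every $r$-permutation of $[n]=\{1,\dots,n\}$ has exactly $n-1$ descents in total, counted over all types $0,1,\dots,r$; that is, $\sum_{i=0}^{r}|\pi^{(i)}|=n-1$.
   Context: An $r$-permutation of $[n]$ is a word $a_1a_2\cdots a_{rn}$ in which each of $1,\dots,n$ appears exactly $r$ times, such that whenever $i<j<k$ and $a_i=a_k$, we have $a_j\le a_i$. For an $r$-permutation $\pi$ and a letter $a$ of $\pi$: $a$ is a type $i$ descent ($1\le i\le r$) if the $i$th occurrence of $a$ is immediately followed by a smaller letter; $a$ is a type $0$ descent if the first occurrence of $a$ immediately follows a smaller letter. $\pi^{(i)}$ denotes the set of type $i$ descents of $\pi$ (a letter may belong to several of these sets). -}

module Defs where

open import Data.Nat using (ℕ; zero; suc; _+_; _*_; _≤_; _<_; _<ᵇ_)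
open import Data.Bool using (Bool; true; false; if_then_else_)
open import Data.Maybe using (Maybe; just; nothing)
open import Data.List using (List; []; _∷_; length; filter; map; upTo; lookup)
open import Data.Nat.ListAction using (sum)
open import Data.List.Membership.Propositional using (_∈_)
open import Data.Fin using (Fin; toℕ)
open import Data.Product using (_×_)
open import Relation.Binary.PropositionalEquality using (_≡_)
open import Relation.Nullary.Decidable using (⌊_⌋)
import Data.Nat as ℕ

-- Words are lists of natural numbers; position indices are 0-based.

count : ℕ → List ℕ → ℕ
count a w = length (filter (λ x → x ℕ.≟ a) w)

IsRPerm : ℕ → ℕ → List ℕ → Set
IsRPerm r n w =
  (length w ≡ r * n)
  × (∀ x → x ∈ w → (1 ≤ x × x ≤ n))
  × (∀ a → 1 ≤ a → a ≤ n → count a w ≡ r)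
  × (∀ (i j k : Fin (length w)) → toℕ i < toℕ j → toℕ j < toℕ k →
       lookup w i ≡ lookup w k → lookup w j ≤ lookup w i)

_!_ : List ℕ → ℕ → Maybe ℕ
[] ! _ = nothing
(x ∷ xs) ! zero = just x
(x ∷ xs) ! suc k = xs ! k

positionsFrom : ℕ → ℕ → List ℕ → List ℕ
positionsFrom a p [] = []
positionsFrom a p (x ∷ xs) =
  if ⌊ x ℕ.≟ a ⌋ then p ∷ positionsFrom a (suc p) xs else positionsFrom a (suc p) xs

positions : ℕ → List ℕ → List ℕ
positions a w = positionsFrom a 0 w

smallerAt : List ℕ → ℕ → ℕ → Bool
smallerAt w p a with w ! p
... | just b  = b <ᵇ a
... | nothing = false

-- isDescent w i a:
--   i = 0     : the first occurrence of a immediately follows a smaller letter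
--   i = k ≥ 1 : the k-th occurrence of a is immediately followed by a smaller letter
isDescent : List ℕ → ℕ → ℕ → Bool
isDescent w zero a with positions a w ! 0
... | just (suc p) = smallerAt w p a
... | just zero    = false
... | nothing      = false
isDescent w (suc k) a with positions a w ! k
... | just p  = smallerAt w (suc p) a
... | nothing = false

descentCount : ℕ → List ℕ → ℕ → ℕ
descentCount n w i = length (filter (λ a → Data.Bool._≟_ (isDescent w i a) true) (map suc (upTo n)))
  where import Data.Bool

totalDescents : ℕ → ℕ → List ℕ → ℕ
totalDescents r n w = sum (map (descentCount n w) (upTo (suc r)))

-- Since every letter occurs r times, the descents of types 1,…,r are exactly the
-- adjacent descents a_p > a_(p+1) of the word, and the type-0 descents are the adjacent
-- ascents a_p < a_(p+1) at which a_(p+1) occurs for the first time.  At an adjacent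
-- descent the right letter is new (an earlier copy would give the pattern x a_p x with
-- x < a_p), and equal neighbours are never new; so each adjacent pair contributes exactly
-- when its right letter is new, which happens once for every letter except a_1.

module Submission where

open import Defs
open import Data.Nat using (ℕ; _≤_; _∸_)
open import Data.List using (List)
open import Relation.Binary.PropositionalEquality using (_≡_)

open import Data.Bool using (Bool; true; false; if_then_else_)
import Data.Bool as Bool
open import Data.Empty using (⊥-elim)
open import Data.Fin using (Fin; toℕ)
open import Data.List using ([]; _∷_; length; filter; map; upTo; applyUpTo; lookup)
open import Data.List.Membership.Propositional using (_∈_)
open import Data.List.Membership.Propositional.Properties using (∈-map⁺; ∈-upTo⁺; ∈-upTo⁻)
open import Data.List.Properties using (length-map; length-upTo; map-applyUpTo; map-cong; map-cong-local; filter-accept; filter-reject)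
open import Data.List.Relation.Unary.All using (All; []; _∷_)
import Data.List.Relation.Unary.All as All
import Data.List.Relation.Unary.All.Properties as All
open import Data.List.Relation.Unary.Any using (here; there)
open import Data.List.Relation.Unary.Unique.Propositional using (Unique; _∷_)
import Data.List.Relation.Unary.Unique.Propositional.Properties as Unique
open import Data.Maybe using (just; nothing; maybe′)
open import Data.Maybe.Properties using (just-injective)
open import Data.Nat using (zero; suc; _+_; _*_; _<_; _<ᵇ_; _≟_; z≤n; s≤s)
open import Data.Nat.ListAction using (sum)
open import Data.Nat.Properties
open import Algebra.Properties.CommutativeSemigroup +-commutativeSemigroup using (interchange; x∙yz≈y∙xz)
open import Data.Product using (_×_; _,_; ∃)
open import Data.Sum using (inj₁; inj₂)
open import Function using (_∘_)
open import Relation.Binary.PropositionalEquality using (_≢_; refl; sym; trans; cong; cong₂; subst; module ≡-Reasoning)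
open import Relation.Nullary using (yes; no; ¬?; ofʸ; ofⁿ)
open import Relation.Nullary.Decidable using (⌊_⌋)

𝟙 : Bool → ℕ
𝟙 true  = 1
𝟙 false = 0

sum-map-zero : ∀ {A : Set} (xs : List A) → sum (map (λ _ → 0) xs) ≡ 0
sum-map-zero []       = refl
sum-map-zero (_ ∷ xs) = sum-map-zero xs

sum-map-+ : ∀ {A : Set} (f g : A → ℕ) xs →
  sum (map (λ a → f a + g a) xs) ≡ sum (map f xs) + sum (map g xs)
sum-map-+ f g []       = refl
sum-map-+ f g (x ∷ xs) =
  trans (cong (f x + g x +_) (sum-map-+ f g xs)) (interchange (f x) (g x) _ _)

sum-map-comm : ∀ {A B : Set} (f : A → B → ℕ) is as →
  sum (map (λ i → sum (map (f i) as)) is) ≡ sum (map (λ a → sum (map (λ i → f i a) is)) as)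
sum-map-comm f []       as = sym (sum-map-zero as)
sum-map-comm f (i ∷ is) as =
  trans (cong (sum (map (f i) as) +_) (sum-map-comm f is as))
        (sym (sum-map-+ (f i) (λ a → sum (map (λ j → f j a) is)) as))

length-filter≡sum-𝟙 : ∀ {A : Set} (f : A → Bool) xs →
  length (filter (λ a → f a Bool.≟ true) xs) ≡ sum (map (𝟙 ∘ f) xs)
length-filter≡sum-𝟙 f []       = refl
length-filter≡sum-𝟙 f (x ∷ xs) with f x
... | true  = cong suc (length-filter≡sum-𝟙 f xs)
... | false = length-filter≡sum-𝟙 f xs

sum-applyUpTo-! : ∀ (F g : ℕ → ℕ) L → (∀ k → F k ≡ maybe′ g 0 (L ! k)) →
  sum (applyUpTo F (length L)) ≡ sum (map g L)
sum-applyUpTo-! F g []      _ = refl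
sum-applyUpTo-! F g (x ∷ L) e = cong₂ _+_ (e 0) (sum-applyUpTo-! (F ∘ suc) g L (e ∘ suc))

remove : ℕ → List ℕ → List ℕ
remove x = filter (λ y → ¬? (y ≟ x))

count-here : ∀ x xs → count x (x ∷ xs) ≡ suc (count x xs)
count-here x xs = cong length (filter-accept (_≟ x) refl)

count-there : ∀ {x y} xs → y ≢ x → count x (y ∷ xs) ≡ count x xs
count-there {x} xs y≢x = cong length (filter-reject (_≟ x) y≢x)

count-≢ : ∀ {x xs} → All (x ≢_) xs → count x xs ≡ 0
count-≢ []           = refl
count-≢ (x≢y ∷ ps) = trans (count-there _ (x≢y ∘ sym)) (count-≢ ps)

count-unique : ∀ {x xs} → Unique xs → x ∈ xs → count x xs ≡ 1
count-unique {x} (x≢ ∷ _)  (here refl) = trans (count-here x _) (cong suc (count-≢ x≢))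
count-unique     (y≢ ∷ u) (there x∈)  =
  trans (count-there _ (All.lookup y≢ x∈)) (count-unique u x∈)

remove-here : ∀ x A → remove x (x ∷ A) ≡ remove x A
remove-here x A = filter-reject (λ y → ¬? (y ≟ x)) (λ x≢x → x≢x refl)

remove-there : ∀ {x a} A → a ≢ x → remove x (a ∷ A) ≡ a ∷ remove x A
remove-there {x} A a≢x = filter-accept (λ y → ¬? (y ≟ x)) a≢x

count-remove-same : ∀ x A → count x (remove x A) ≡ 0
count-remove-same x []      = refl
count-remove-same x (a ∷ A) with a ≟ x
... | yes refl = trans (cong (count x) (remove-here x A)) (count-remove-same x A)
... | no  a≢x  = begin
  count x (remove x (a ∷ A)) ≡⟨ cong (count x) (remove-there A a≢x) ⟩
  count x (a ∷ remove x A)   ≡⟨ count-there (remove x A) a≢x ⟩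
  count x (remove x A)       ≡⟨ count-remove-same x A ⟩
  0                          ∎
  where open ≡-Reasoning

count-remove-other : ∀ {y x} A → y ≢ x → count y (remove x A) ≡ count y A
count-remove-other []      _   = refl
count-remove-other {y} {x} (a ∷ A) y≢x with a ≟ x
... | yes refl = begin
  count y (remove x (x ∷ A)) ≡⟨ cong (count y) (remove-here x A) ⟩
  count y (remove x A)       ≡⟨ count-remove-other A y≢x ⟩
  count y A                  ≡⟨ count-there A (y≢x ∘ sym) ⟨
  count y (x ∷ A)            ∎
  where open ≡-Reasoning
... | no a≢x = trans (cong (count y) (remove-there A a≢x)) (count-cons-cong a (count-remove-other A y≢x))
  where
  count-cons-cong : ∀ a {xs ys} → count y xs ≡ count y ys → count y (a ∷ xs) ≡ count y (a ∷ ys)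
  count-cons-cong a eq with a ≟ y
  ... | yes refl = trans (count-here y _) (trans (cong suc eq) (sym (count-here y _)))
  ... | no a≢y   = trans (count-there _ a≢y) (trans eq (sym (count-there _ a≢y)))

length-count-remove : ∀ x A → length A ≡ count x A + length (remove x A)
length-count-remove x []      = refl
length-count-remove x (a ∷ A) with a ≟ x
... | yes refl = begin
  suc (length A)                             ≡⟨ cong suc (length-count-remove x A) ⟩
  suc (count x A + length (remove x A))      ≡⟨ cong₂ (λ c l → c + length l) (count-here x A) (remove-here x A) ⟨
  count x (x ∷ A) + length (remove x (x ∷ A)) ∎
  where open ≡-Reasoning
... | no a≢x = begin
  suc (length A)                             ≡⟨ cong suc (length-count-remove x A) ⟩
  suc (count x A + length (remove x A))      ≡⟨ +-suc _ _ ⟨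
  count x A + length (a ∷ remove x A)        ≡⟨ cong₂ (λ c l → c + length l) (count-there A a≢x) (remove-there A a≢x) ⟨
  count x (a ∷ A) + length (remove x (a ∷ A)) ∎
  where open ≡-Reasoning

InRange : ℕ → ℕ → Set
InRange n a = 1 ≤ a × a ≤ n

letters : ℕ → List ℕ
letters n = map suc (upTo n)

length-letters : ∀ n → length (letters n) ≡ n
length-letters n = trans (length-map suc (upTo n)) (length-upTo n)

count-letters : ∀ {n a} → InRange n a → count a (letters n) ≡ 1
count-letters {n} {suc a} (_ , a<n) =
  count-unique (Unique.map⁺ suc-injective (Unique.upTo⁺ n)) (∈-map⁺ suc (∈-upTo⁺ a<n))

letters-inRange : ∀ n → All (InRange n) (letters n)
letters-inRange n = All.map⁺ (All.tabulate (λ i∈ → s≤s z≤n , ∈-upTo⁻ i∈))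

length-positionsFrom : ∀ a s xs → length (positionsFrom a s xs) ≡ count a xs
length-positionsFrom a s []       = refl
length-positionsFrom a s (x ∷ xs) with x ≟ a
... | yes refl = trans (cong suc (length-positionsFrom a (suc s) xs)) (sym (count-here a xs))
... | no  x≢a  = trans (length-positionsFrom a (suc s) xs) (sym (count-there xs x≢a))

smallerBefore : List ℕ → ℕ → ℕ → ℕ
smallerBefore W zero    a = 0
smallerBefore W (suc p) a = 𝟙 (smallerAt W p a)

smallerAfter : List ℕ → ℕ → ℕ → ℕ
smallerAfter W p a = 𝟙 (smallerAt W (suc p) a)

isDescent-zero : ∀ W a →
  𝟙 (isDescent W 0 a) ≡ maybe′ (λ p → smallerBefore W p a) 0 (positions a W ! 0)
isDescent-zero W a with positions a W ! 0
... | just zero    = refl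
... | just (suc p) = refl
... | nothing      = refl

isDescent-suc : ∀ W k a →
  𝟙 (isDescent W (suc k) a) ≡ maybe′ (λ p → smallerAfter W p a) 0 (positions a W ! k)
isDescent-suc W k a with positions a W ! k
... | just p  = refl
... | nothing = refl

sum-descentTypes : ∀ r W a → count a W ≡ r →
  sum (map (λ i → 𝟙 (isDescent W i a)) (upTo (suc r)))
    ≡ maybe′ (λ p → smallerBefore W p a) 0 (positions a W ! 0)
      + sum (map (λ p → smallerAfter W p a) (positions a W))
sum-descentTypes _ W a refl = cong₂ _+_ (isDescent-zero W a) (begin
  sum (map D (applyUpTo suc (count a W)))
    ≡⟨ cong sum (map-applyUpTo suc D (count a W)) ⟩
  sum (applyUpTo (D ∘ suc) (count a W))
    ≡⟨ cong (sum ∘ applyUpTo (D ∘ suc)) (length-positionsFrom a 0 W) ⟨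
  sum (applyUpTo (D ∘ suc) (length (positions a W)))
    ≡⟨ sum-applyUpTo-! (D ∘ suc) _ (positions a W) (λ k → isDescent-suc W k a) ⟩
  sum (map (λ p → smallerAfter W p a) (positions a W)) ∎)
  where
  open ≡-Reasoning
  D : ℕ → ℕ
  D i = 𝟙 (isDescent W i a)

occurrenceSum : List ℕ → (ℕ → ℕ → ℕ) → ℕ → List ℕ → ℕ
occurrenceSum A h s []       = 0
occurrenceSum A h s (x ∷ xs) = count x A * h s x + occurrenceSum A h (suc s) xs

firstOccurrenceSum : List ℕ → (ℕ → ℕ → ℕ) → ℕ → List ℕ → ℕ
firstOccurrenceSum A h s []       = 0
firstOccurrenceSum A h s (x ∷ xs) = count x A * h s x + firstOccurrenceSum (remove x A) h (suc s) xs

sum-map-select : ∀ (h g : ℕ → ℕ) x A →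
  sum (map (λ a → if ⌊ x ≟ a ⌋ then h a else g a) A) ≡ count x A * h x + sum (map g (remove x A))
sum-map-select h g x []      = refl
sum-map-select h g x (a ∷ A) with x ≟ a
... | yes refl = trans (cong (h x +_) (sum-map-select h g x A)) (begin
  h x + (count x A * h x + sum (map g (remove x A)))
    ≡⟨ +-assoc (h x) _ _ ⟨
  suc (count x A) * h x + sum (map g (remove x A))
    ≡⟨ cong₂ (λ c l → c * h x + sum (map g l)) (count-here x A) (remove-here x A) ⟨
  count x (x ∷ A) * h x + sum (map g (remove x (x ∷ A))) ∎)
  where open ≡-Reasoning
... | no x≢a = trans (cong (g a +_) (sum-map-select h g x A)) (begin
  g a + (count x A * h x + sum (map g (remove x A)))
    ≡⟨ x∙yz≈y∙xz (g a) (count x A * h x) _ ⟩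
  count x A * h x + sum (map g (a ∷ remove x A))
    ≡⟨ cong₂ (λ c l → c * h x + sum (map g l)) (count-there A a≢x) (remove-there A a≢x) ⟨
  count x (a ∷ A) * h x + sum (map g (remove x (a ∷ A))) ∎)
  where
  open ≡-Reasoning
  a≢x : a ≢ x
  a≢x = x≢a ∘ sym

sum-positionsFrom : ∀ A (h : ℕ → ℕ → ℕ) s xs →
  sum (map (λ a → sum (map (λ p → h p a) (positionsFrom a s xs))) A) ≡ occurrenceSum A h s xs
sum-positionsFrom A h s []       = sum-map-zero A
sum-positionsFrom A h s (x ∷ xs) = begin
  sum (map (λ a → sum (map (λ p → h p a) (positionsFrom a s (x ∷ xs)))) A)
    ≡⟨ cong sum (map-cong split A) ⟩
  sum (map (λ a → now a + later a) A)
    ≡⟨ sum-map-+ now later A ⟩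
  sum (map now A) + sum (map later A)
    ≡⟨ cong₂ _+_ (sum-map-select (h s) (λ _ → 0) x A) (sum-positionsFrom A h (suc s) xs) ⟩
  count x A * h s x + sum (map (λ _ → 0) (remove x A)) + occurrenceSum A h (suc s) xs
    ≡⟨ cong (λ z → count x A * h s x + z + occurrenceSum A h (suc s) xs) (sum-map-zero (remove x A)) ⟩
  count x A * h s x + 0 + occurrenceSum A h (suc s) xs
    ≡⟨ cong (_+ occurrenceSum A h (suc s) xs) (+-identityʳ _) ⟩
  occurrenceSum A h s (x ∷ xs) ∎
  where
  open ≡-Reasoning
  now later : ℕ → ℕ
  now  a = if ⌊ x ≟ a ⌋ then h s a else 0
  later a = sum (map (λ p → h p a) (positionsFrom a (suc s) xs))
  split : ∀ a → sum (map (λ p → h p a) (positionsFrom a s (x ∷ xs))) ≡ now a + later a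
  split a with x ≟ a
  ... | yes _ = refl
  ... | no  _ = refl

sum-firstPosition : ∀ A (h : ℕ → ℕ → ℕ) s xs →
  sum (map (λ a → maybe′ (λ p → h p a) 0 (positionsFrom a s xs ! 0)) A) ≡ firstOccurrenceSum A h s xs
sum-firstPosition A h s []       = sum-map-zero A
sum-firstPosition A h s (x ∷ xs) = begin
  sum (map (λ a → first a s (x ∷ xs)) A)
    ≡⟨ cong sum (map-cong split A) ⟩
  sum (map (λ a → if ⌊ x ≟ a ⌋ then h s a else first a (suc s) xs) A)
    ≡⟨ sum-map-select (h s) (λ a → first a (suc s) xs) x A ⟩
  count x A * h s x + sum (map (λ a → first a (suc s) xs) (remove x A))
    ≡⟨ cong (count x A * h s x +_) (sum-firstPosition (remove x A) h (suc s) xs) ⟩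
  firstOccurrenceSum A h s (x ∷ xs) ∎
  where
  open ≡-Reasoning
  first : ℕ → ℕ → List ℕ → ℕ
  first a t ys = maybe′ (λ p → h p a) 0 (positionsFrom a t ys ! 0)
  split : ∀ a → first a s (x ∷ xs) ≡ (if ⌊ x ≟ a ⌋ then h s a else first a (suc s) xs)
  split a with x ≟ a
  ... | yes _ = refl
  ... | no  _ = refl

totalDescents≡firstOccurrenceSum+occurrenceSum : ∀ r n W → (∀ {a} → InRange n a → count a W ≡ r) →
  totalDescents r n W
    ≡ firstOccurrenceSum (letters n) (smallerBefore W) 0 W + occurrenceSum (letters n) (smallerAfter W) 0 W
totalDescents≡firstOccurrenceSum+occurrenceSum r n W count≡r = begin
  totalDescents r n W
    ≡⟨ cong sum (map-cong (λ i → length-filter≡sum-𝟙 (isDescent W i) (letters n)) (upTo (suc r))) ⟩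
  sum (map (λ i → sum (map (λ a → D i a) (letters n))) (upTo (suc r)))
    ≡⟨ sum-map-comm D (upTo (suc r)) (letters n) ⟩
  sum (map (λ a → sum (map (λ i → D i a) (upTo (suc r)))) (letters n))
    ≡⟨ cong sum (map-cong-local (All.map (λ {a} a∈ → sum-descentTypes r W a (count≡r a∈)) (letters-inRange n))) ⟩
  sum (map (λ a → first a + later a) (letters n))
    ≡⟨ sum-map-+ first later (letters n) ⟩
  sum (map first (letters n)) + sum (map later (letters n))
    ≡⟨ cong₂ _+_ (sum-firstPosition (letters n) (smallerBefore W) 0 W) (sum-positionsFrom (letters n) (smallerAfter W) 0 W) ⟩
  firstOccurrenceSum (letters n) (smallerBefore W) 0 W + occurrenceSum (letters n) (smallerAfter W) 0 W ∎
  where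
  open ≡-Reasoning
  D : ℕ → ℕ → ℕ
  D i a = 𝟙 (isDescent W i a)
  first later : ℕ → ℕ
  first a = maybe′ (λ p → smallerBefore W p a) 0 (positions a W ! 0)
  later a = sum (map (λ p → smallerAfter W p a) (positions a W))

descents : List ℕ → ℕ
descents (x ∷ y ∷ ys) = 𝟙 (y <ᵇ x) + descents (y ∷ ys)
descents _            = 0

-- A holds the letters not seen yet, so count x A * 𝟙 (prev <ᵇ x) detects a type-0 descent at x.
freshAscents : ℕ → List ℕ → List ℕ → ℕ
freshAscents prev A []       = 0
freshAscents prev A (x ∷ xs) = count x A * 𝟙 (prev <ᵇ x) + freshAscents x (remove x A) xs

SuffixFrom : List ℕ → ℕ → List ℕ → Set
SuffixFrom W s xs = ∀ j → W ! (j + s) ≡ xs ! j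

SuffixFrom-refl : ∀ W → SuffixFrom W 0 W
SuffixFrom-refl W j = cong (W !_) (+-identityʳ j)

SuffixFrom-tail : ∀ {W s x xs} → SuffixFrom W s (x ∷ xs) → SuffixFrom W (suc s) xs
SuffixFrom-tail {W} {s} suf j = trans (cong (W !_) (+-suc j s)) (suf (suc j))

smallerAt≡ : ∀ W p a → smallerAt W p a ≡ maybe′ (_<ᵇ a) false (W ! p)
smallerAt≡ W p a with W ! p
... | just _  = refl
... | nothing = refl

descents-∷ : ∀ x xs → 𝟙 (maybe′ (_<ᵇ x) false (xs ! 0)) + descents xs ≡ descents (x ∷ xs)
descents-∷ x []       = refl
descents-∷ x (y ∷ ys) = refl

occurrenceSum-descents : ∀ {W n s} xs → All (InRange n) xs → SuffixFrom W s xs →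
  occurrenceSum (letters n) (smallerAfter W) s xs ≡ descents xs
occurrenceSum-descents []       _          _   = refl
occurrenceSum-descents {W} {n} {s} (x ∷ xs) (x∈ ∷ xs∈) suf = begin
  count x (letters n) * smallerAfter W s x + occurrenceSum (letters n) (smallerAfter W) (suc s) xs
    ≡⟨ cong₂ _+_ (trans (cong (_* smallerAfter W s x) (count-letters x∈)) (*-identityˡ _))
                 (occurrenceSum-descents {W} xs xs∈ (SuffixFrom-tail {W} suf)) ⟩
  𝟙 (smallerAt W (suc s) x) + descents xs
    ≡⟨ cong (λ b → 𝟙 b + descents xs) (trans (smallerAt≡ W (suc s) x) (cong (maybe′ (_<ᵇ x) false) (suf 1))) ⟩
  𝟙 (maybe′ (_<ᵇ x) false (xs ! 0)) + descents xs
    ≡⟨ descents-∷ x xs ⟩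
  descents (x ∷ xs) ∎
  where open ≡-Reasoning

firstOccurrenceSum-freshAscents : ∀ {W q prev} A xs → SuffixFrom W q (prev ∷ xs) →
  firstOccurrenceSum A (smallerBefore W) (suc q) xs ≡ freshAscents prev A xs
firstOccurrenceSum-freshAscents A []       _ = refl
firstOccurrenceSum-freshAscents {W} {q} A (x ∷ xs) suf = cong₂ _+_
  (cong (λ b → count x A * 𝟙 b) (trans (smallerAt≡ W q x) (cong (maybe′ (_<ᵇ x) false) (suf 0))))
  (firstOccurrenceSum-freshAscents {W} (remove x A) xs (SuffixFrom-tail {W} suf))

descent+freshAscent≡fresh : ∀ x prev c → (x < prev → c ≡ 1) → (x ≡ prev → c ≡ 0) →
  𝟙 (x <ᵇ prev) + c * 𝟙 (prev <ᵇ x) ≡ c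
descent+freshAscent≡fresh x prev c fresh repeated
  with x <ᵇ prev | <ᵇ-reflects-< x prev | prev <ᵇ x | <ᵇ-reflects-< prev x
... | true  | ofʸ x<p | true  | ofʸ p<x = ⊥-elim (<-asym x<p p<x)
... | true  | ofʸ x<p | false | _       = trans (cong suc (*-zeroʳ c)) (sym (fresh x<p))
... | false | _       | true  | _       = *-identityʳ c
... | false | ofⁿ x≮p | false | ofⁿ p≮x =
  trans (*-zeroʳ c) (sym (repeated (≤-antisym (≮⇒≥ p≮x) (≮⇒≥ x≮p))))

!-just-< : ∀ V {m i a} → V ! m ≡ nothing → V ! i ≡ just a → i < m
!-just-< []      _  ()
!-just-< (x ∷ V) {zero}          ()
!-just-< (x ∷ V) {suc m} {zero}  _  _  = s≤s z≤n
!-just-< (x ∷ V) {suc m} {suc i} e  e′ = s≤s (!-just-< V e e′)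

!⇒lookup : ∀ V {i a} → V ! i ≡ just a → ∃ λ (f : Fin (length V)) → toℕ f ≡ i × lookup V f ≡ a
!⇒lookup []      ()
!⇒lookup (x ∷ V) {zero}  refl = Data.Fin.zero , refl , refl
!⇒lookup (x ∷ V) {suc i} e with !⇒lookup V e
... | f , refl , l = Data.Fin.suc f , refl , l

count>0⇒! : ∀ V {a} → 0 < count a V → ∃ λ i → V ! i ≡ just a
count>0⇒! []      ()
count>0⇒! (x ∷ V) {a} pos with x ≟ a
... | yes refl = 0 , refl
... | no  x≢a with count>0⇒! V (subst (0 <_) (count-there V x≢a) pos)
...   | i , e = suc i , e

Avoids121 : List ℕ → Set
Avoids121 W = ∀ {i j k a b} → i < j → j < k → W ! i ≡ just a → W ! j ≡ just b → W ! k ≡ just a → b ≤ a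

avoids121-fromLookup : ∀ W →
  (∀ (i j k : Fin (length W)) → toℕ i < toℕ j → toℕ j < toℕ k → lookup W i ≡ lookup W k → lookup W j ≤ lookup W i) →
  Avoids121 W
avoids121-fromLookup W nested i<j j<k ei ej ek
  with !⇒lookup W ei | !⇒lookup W ej | !⇒lookup W ek
... | fi , refl , refl | fj , refl , refl | fk , refl , lk = nested fi fj fk i<j j<k (sym lk)

record Unseen (W : List ℕ) (n q : ℕ) (A : List ℕ) : Set where
  field
    inRange : All (InRange n) A
    seen    : ∀ {i a} → i ≤ q → W ! i ≡ just a → count a A ≡ 0
    unseen  : ∀ {a} → InRange n a → (∀ {i} → i ≤ q → W ! i ≢ just a) → count a A ≡ 1

Unseen-step : ∀ {W n q prev x xs A} → SuffixFrom W q (prev ∷ x ∷ xs) → Unseen W n q A →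
  Unseen W n (suc q) (remove x A)
Unseen-step {W} {q = q} {x = x} {A = A} suf U = record
  { inRange = All.filter⁺ (λ y → ¬? (y ≟ x)) (Unseen.inRange U)
  ; seen    = seen
  ; unseen  = λ a∈ notSeen →
      trans (count-remove-other A (λ { refl → notSeen ≤-refl (suf 1) }))
            (Unseen.unseen U a∈ (notSeen ∘ m≤n⇒m≤1+n))
  }
  where
  seen : ∀ {i a} → i ≤ suc q → W ! i ≡ just a → count a (remove x A) ≡ 0
  seen {a = a} i≤1+q e with a ≟ x | m≤n⇒m<n∨m≡n i≤1+q
  ... | yes refl | _            = count-remove-same x A
  ... | no a≢x   | inj₁ i<1+q   = trans (count-remove-other A a≢x) (Unseen.seen U (≤-pred i<1+q) e)
  ... | no a≢x   | inj₂ refl    = ⊥-elim (a≢x (just-injective (trans (sym e) (suf 1))))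

module _ {W : List ℕ} {n : ℕ} (avoids : Avoids121 W) (occurs : ∀ {a} → InRange n a → ∃ λ i → W ! i ≡ just a) where

  descent⇒unseen : ∀ {q prev x i} → W ! q ≡ just prev → W ! suc q ≡ just x → x < prev →
    i ≤ q → W ! i ≢ just x
  descent⇒unseen wq wsq x<p i≤q e with m≤n⇒m<n∨m≡n i≤q
  ... | inj₁ i<q  = <⇒≱ x<p (avoids i<q ≤-refl e wq wsq)
  ... | inj₂ refl = <⇒≢ x<p (just-injective (trans (sym e) wq))

  descents+freshAscents≡length : ∀ {q prev A} xs → SuffixFrom W q (prev ∷ xs) → Unseen W n q A →
    All (InRange n) xs → descents (prev ∷ xs) + freshAscents prev A xs ≡ length A
  descents+freshAscents≡length {A = []}    [] _   _ _ = refl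
  descents+freshAscents≡length {A = y ∷ A} [] suf U _ =
    let i , e = occurs (All.head (Unseen.inRange U))
    in ⊥-elim (1+n≢0 (trans (sym (count-here y A)) (Unseen.seen U (≤-pred (!-just-< W (suf 1) e)) e)))
  descents+freshAscents≡length {q} {prev} {A} (x ∷ xs) suf U (x∈ ∷ xs∈) = begin
    (𝟙 (x <ᵇ prev) + descents (x ∷ xs)) + (count x A * 𝟙 (prev <ᵇ x) + freshAscents x (remove x A) xs)
      ≡⟨ interchange (𝟙 (x <ᵇ prev)) (descents (x ∷ xs)) _ _ ⟩
    (𝟙 (x <ᵇ prev) + count x A * 𝟙 (prev <ᵇ x)) + (descents (x ∷ xs) + freshAscents x (remove x A) xs)
      ≡⟨ cong₂ _+_ (descent+freshAscent≡fresh x prev (count x A) fresh repeated)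
                   (descents+freshAscents≡length xs (SuffixFrom-tail {W} suf) (Unseen-step suf U) xs∈) ⟩
    count x A + length (remove x A)
      ≡⟨ length-count-remove x A ⟨
    length A ∎
    where
    open ≡-Reasoning
    fresh : x < prev → count x A ≡ 1
    fresh x<p = Unseen.unseen U x∈ (λ i≤q → descent⇒unseen (suf 0) (suf 1) x<p i≤q)
    repeated : x ≡ prev → count x A ≡ 0
    repeated refl = Unseen.seen U ≤-refl (suf 0)

length-remove-letters : ∀ {n a} → InRange n a → length (remove a (letters n)) ≡ n ∸ 1
length-remove-letters {n} {a} a∈ = sym (cong (_∸ 1) (begin
  n                                                     ≡⟨ length-letters n ⟨
  length (letters n)                                    ≡⟨ length-count-remove a (letters n) ⟩
  count a (letters n) + length (remove a (letters n))   ≡⟨ cong (_+ length (remove a (letters n))) (count-letters a∈) ⟩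
  1 + length (remove a (letters n))                     ∎))
  where open ≡-Reasoning

Unseen-start : ∀ {n w ws} → InRange n w → Unseen (w ∷ ws) n 0 (remove w (letters n))
Unseen-start {n} {w} w∈ = record
  { inRange = All.filter⁺ (λ y → ¬? (y ≟ w)) (letters-inRange n)
  ; seen    = λ { z≤n refl → count-remove-same w (letters n) }
  ; unseen  = λ a∈ notSeen →
      trans (count-remove-other (letters n) (λ { refl → notSeen z≤n refl })) (count-letters a∈)
  }

totalDescents≡descents+freshAscents : ∀ r n w ws → (∀ {a} → InRange n a → count a (w ∷ ws) ≡ r) →
  All (InRange n) (w ∷ ws) →
  totalDescents r n (w ∷ ws) ≡ descents (w ∷ ws) + freshAscents w (remove w (letters n)) ws
totalDescents≡descents+freshAscents r n w ws count≡r W∈ = begin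
  totalDescents r n W
    ≡⟨ totalDescents≡firstOccurrenceSum+occurrenceSum r n W count≡r ⟩
  count w (letters n) * 0 + firstOccurrenceSum A (smallerBefore W) 1 ws
    + occurrenceSum (letters n) (smallerAfter W) 0 W
    ≡⟨ cong₂ _+_ (cong₂ _+_ (*-zeroʳ (count w (letters n))) (firstOccurrenceSum-freshAscents {W} A ws (SuffixFrom-refl W)))
                 (occurrenceSum-descents {W} W W∈ (SuffixFrom-refl W)) ⟩
  freshAscents w A ws + descents W
    ≡⟨ +-comm _ (descents W) ⟩
  descents W + freshAscents w A ws ∎
  where
  open ≡-Reasoning
  W A : List ℕ
  W = w ∷ ws
  A = remove w (letters n)

lemma1 : (r n : ℕ) → 1 ≤ r → 1 ≤ n → (w : List ℕ) → IsRPerm r n w →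
    totalDescents r n w ≡ n ∸ 1
lemma1 r n 1≤r 1≤n [] (_ , _ , count≡r , _) = ⊥-elim (<⇒≢ 1≤r (count≡r 1 ≤-refl 1≤n))
lemma1 r n 1≤r 1≤n W@(w ∷ ws) (_ , inW , count≡r , nested) = begin
  totalDescents r n W
    ≡⟨ totalDescents≡descents+freshAscents r n w ws count≡r′ W∈ ⟩
  descents W + freshAscents w (remove w (letters n)) ws
    ≡⟨ descents+freshAscents≡length (avoids121-fromLookup W nested) occurs ws (SuffixFrom-refl W)
         (Unseen-start (All.head W∈)) (All.tail W∈) ⟩
  length (remove w (letters n))
    ≡⟨ length-remove-letters (All.head W∈) ⟩
  n ∸ 1 ∎
  where
  open ≡-Reasoning
  count≡r′ : ∀ {a} → InRange n a → count a W ≡ r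
  count≡r′ (1≤a , a≤n) = count≡r _ 1≤a a≤n
  W∈ : All (InRange n) W
  W∈ = All.tabulate (inW _)
  occurs : ∀ {a} → InRange n a → ∃ λ i → W ! i ≡ just a
  occurs a∈ = count>0⇒! W (subst (0 <_) (sym (count≡r′ a∈)) 1≤r)
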